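{- Let $B$ be a Boolean algebra and let $b,c$ be elements of the interval algebra of $B$. Then $b\sim c$ if and only if $\ell(b)=\ell(c)$.
   Context: The interval algebra of a Boolean algebra $B$ is $\{[a,b]: a\le b\text{ in }B\}$ ordered by inclusion, with top $[0,1]$, join $[a,b]\vee[c,d]=[a\wedge c,b\vee d]$ and $\Delta([a,b],[c,d])=[a\vee(b\wedge\neg d),\,b\wedge(a\vee\neg c)]$. For elements $x,y$, $x\sim y$ means $\Delta(x\vee y,x)=y$. The length of an interval $x=[x_0,x_1]$ is $\ell(x)=\neg x_0\wedge x_1$. -}

module Defs where

open import Level using (Level; _⊔_)
open import Data.Product using (_×_)
open import Algebra.Lattice.Bundles using (BooleanAlgebra)

module IntervalAlgebra {c ℓ : Level} (B : BooleanAlgebra c ℓ) where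
  open BooleanAlgebra B

  _≤ᴮ_ : Carrier → Carrier → Set ℓ
  a ≤ᴮ b = a ∧ b ≈ a

  record Interval : Set (c ⊔ ℓ) where
    constructor [_,_]⟨_⟩
    field
      lo : Carrier
      hi : Carrier
      lo≤hi : lo ≤ᴮ hi
  open Interval public

  _≈ᴵ_ : Interval → Interval → Set ℓ
  x ≈ᴵ y = (lo x ≈ lo y) × (hi x ≈ hi y)

  -- join  [a,b] ∨ [c,d] = [a ∧ c , b ∨ d]
  -- (well-defined: a ∧ c ≤ a ≤ b ≤ b ∨ d; the raw components are what matter)
  joinLo joinHi : Interval → Interval → Carrier
  joinLo x y = lo x ∧ lo y
  joinHi x y = hi x ∨ hi y

  ΔLo ΔHi : Carrier → Carrier → Carrier → Carrier → Carrier
  ΔLo a b c d = a ∨ (b ∧ ¬ d)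
  ΔHi a b c d = b ∧ (a ∨ ¬ c)

  _∼_ : Interval → Interval → Set ℓ
  x ∼ y = (ΔLo (joinLo x y) (joinHi x y) (lo x) (hi x) ≈ lo y)
        × (ΔHi (joinLo x y) (joinHi x y) (lo x) (hi x) ≈ hi y)

  len : Interval → Carrier
  len x = ¬ lo x ∧ hi x

open import Function.Bundles using (_⇔_)

Cor2p9 : {c ℓ : Level} (B : BooleanAlgebra c ℓ) → Set (c ⊔ ℓ)
Cor2p9 B = (b d : Interval) → (b ∼ d) ⇔ (len b ≈ len d)
  where
  open BooleanAlgebra B using (_≈_)
  open IntervalAlgebra B

module Submission where

-- Unfolding the definitions, each direction is a conditional equation
-- between Boolean terms in the four endpoints, under the hypotheses
-- b₀ ≤ b₁ and d₀ ≤ d₁.  Such a Horn clause holds in every Boolean algebra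
-- as soon as the corresponding propositional formula is a tautology, i.e.
-- holds in the two-element algebra.

open import Defs
open import Level using (Level)
open import Algebra.Lattice.Bundles using (BooleanAlgebra)
open import Data.Nat using (ℕ; zero; suc)
open import Data.Fin using (Fin; zero; suc)
open import Data.Bool as Bool using (Bool; true; false; T)
open import Data.Bool.Properties using (T-∧)
open import Data.List using (List; []; _∷_; _++_)
open import Data.List.Relation.Unary.All using (All; []; _∷_)
open import Data.List.Relation.Unary.All.Properties using (++⁺)
open import Data.Product using (_×_; _,_; proj₁; proj₂)
open import Data.Unit using (tt)
open import Data.Vec.Functional using (tail) renaming ([] to []ᵛ; _∷_ to _∷ᵛ_)
open import Function.Bundles using (mk⇔; Equivalence)
open import Relation.Binary.PropositionalEquality as ≡ using (_≡_)

module BooleanTerms {c ℓ : Level} (B : BooleanAlgebra c ℓ) where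
  open BooleanAlgebra B
  open import Algebra.Lattice.Properties.BooleanAlgebra B
  open import Algebra.Bundles using (CommutativeMonoid; CommutativeSemiring)
  open import Algebra.Properties.CommutativeSemigroup
    (CommutativeMonoid.commutativeSemigroup
      (CommutativeSemiring.+-commutativeMonoid ∧-∨-commutativeSemiring))
    using (interchange)
  open import Relation.Binary.Reasoning.Setoid setoid

  infixr 7 _∧ₑ_
  infixr 6 _∨ₑ_

  data Expr (n : ℕ) : Set where
    var     : Fin n → Expr n
    ⊤ₑ ⊥ₑ   : Expr n
    _∧ₑ_ _∨ₑ_ : Expr n → Expr n → Expr n
    ¬ₑ_     : Expr n → Expr n

  ⟦_⟧ : ∀ {n} → Expr n → (Fin n → Carrier) → Carrier
  ⟦ var i ⟧  ρ = ρ i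
  ⟦ ⊤ₑ ⟧     ρ = ⊤
  ⟦ ⊥ₑ ⟧     ρ = ⊥
  ⟦ e ∧ₑ f ⟧ ρ = ⟦ e ⟧ ρ ∧ ⟦ f ⟧ ρ
  ⟦ e ∨ₑ f ⟧ ρ = ⟦ e ⟧ ρ ∨ ⟦ f ⟧ ρ
  ⟦ ¬ₑ e ⟧   ρ = ¬ ⟦ e ⟧ ρ

  bool : Bool → Carrier
  bool true  = ⊤
  bool false = ⊥

  constant : Bool → ∀ {n} → Expr n
  constant true  = ⊤ₑ
  constant false = ⊥ₑ

  instantiate : ∀ {n} → Bool → Expr (suc n) → Expr n
  instantiate v (var zero)    = constant v
  instantiate v (var (suc i)) = var i
  instantiate v ⊤ₑ            = ⊤ₑ
  instantiate v ⊥ₑ            = ⊥ₑ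
  instantiate v (e ∧ₑ f)      = instantiate v e ∧ₑ instantiate v f
  instantiate v (e ∨ₑ f)      = instantiate v e ∨ₑ instantiate v f
  instantiate v (¬ₑ e)        = ¬ₑ instantiate v e

  instantiate-sem : ∀ {n} v (e : Expr (suc n)) (ρ : Fin n → Carrier) →
                    ⟦ instantiate v e ⟧ ρ ≡ ⟦ e ⟧ (bool v ∷ᵛ ρ)
  instantiate-sem true  (var zero)    ρ = ≡.refl
  instantiate-sem false (var zero)    ρ = ≡.refl
  instantiate-sem v     (var (suc i)) ρ = ≡.refl
  instantiate-sem v     ⊤ₑ            ρ = ≡.refl
  instantiate-sem v     ⊥ₑ            ρ = ≡.refl
  instantiate-sem v (e ∧ₑ f) ρ = ≡.cong₂ _∧_ (instantiate-sem v e ρ) (instantiate-sem v f ρ)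
  instantiate-sem v (e ∨ₑ f) ρ = ≡.cong₂ _∨_ (instantiate-sem v e ρ) (instantiate-sem v f ρ)
  instantiate-sem v (¬ₑ e)   ρ = ≡.cong ¬_ (instantiate-sem v e ρ)

  -- Closed terms are evaluated in the two-element algebra; `bool` is a
  -- homomorphism, so this computes their value in B.
  evaluate : Expr 0 → Bool
  evaluate ⊤ₑ       = true
  evaluate ⊥ₑ       = false
  evaluate (e ∧ₑ f) = evaluate e Bool.∧ evaluate f
  evaluate (e ∨ₑ f) = evaluate e Bool.∨ evaluate f
  evaluate (¬ₑ e)   = Bool.not (evaluate e)

  bool-∧ : ∀ u v → bool u ∧ bool v ≈ bool (u Bool.∧ v)
  bool-∧ true  v = ∧-identityˡ _
  bool-∧ false v = ∧-zeroˡ _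

  bool-∨ : ∀ u v → bool u ∨ bool v ≈ bool (u Bool.∨ v)
  bool-∨ true  v = ∨-zeroˡ _
  bool-∨ false v = ∨-identityˡ _

  bool-¬ : ∀ u → ¬ bool u ≈ bool (Bool.not u)
  bool-¬ true  = ¬⊤≈⊥
  bool-¬ false = ¬⊥≈⊤

  evaluate-sound : (e : Expr 0) (ρ : Fin 0 → Carrier) → ⟦ e ⟧ ρ ≈ bool (evaluate e)
  evaluate-sound ⊤ₑ       ρ = refl
  evaluate-sound ⊥ₑ       ρ = refl
  evaluate-sound (e ∧ₑ f) ρ =
    trans (∧-cong (evaluate-sound e ρ) (evaluate-sound f ρ)) (bool-∧ (evaluate e) (evaluate f))
  evaluate-sound (e ∨ₑ f) ρ =
    trans (∨-cong (evaluate-sound e ρ) (evaluate-sound f ρ)) (bool-∨ (evaluate e) (evaluate f))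
  evaluate-sound (¬ₑ e)   ρ = trans (¬-cong (evaluate-sound e ρ)) (bool-¬ (evaluate e))

  isTautology : ∀ n → Expr n → Bool
  isTautology zero    e = evaluate e
  isTautology (suc n) e = isTautology n (instantiate true e) Bool.∧ isTautology n (instantiate false e)

  -- Meeting with a fixed u is a Boolean homomorphism onto the interval
  -- [⊥ , u]; hence terms respect agreement of environments below u.
  ∧-guard : ∀ u x y → u ∧ (x ∧ y) ≈ (u ∧ x) ∧ (u ∧ y)
  ∧-guard u x y = begin
    u ∧ (x ∧ y)        ≈⟨ ∧-congʳ (∧-idem u) ⟨
    (u ∧ u) ∧ (x ∧ y)  ≈⟨ interchange u u x y ⟩
    (u ∧ x) ∧ (u ∧ y)  ∎

  ¬-guard : ∀ u x → u ∧ ¬ x ≈ u ∧ ¬ (u ∧ x)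
  ¬-guard u x = begin
    u ∧ ¬ x                ≈⟨ ∨-identityˡ _ ⟨
    ⊥ ∨ (u ∧ ¬ x)          ≈⟨ ∨-congʳ (∧-complementʳ u) ⟨
    (u ∧ ¬ u) ∨ (u ∧ ¬ x)  ≈⟨ ∧-distribˡ-∨ u (¬ u) (¬ x) ⟨
    u ∧ (¬ u ∨ ¬ x)        ≈⟨ ∧-congˡ (deMorgan₁ u x) ⟨
    u ∧ ¬ (u ∧ x)          ∎

  guarded-congruence : ∀ {n} u (ρ σ : Fin n → Carrier) → (∀ i → u ∧ ρ i ≈ u ∧ σ i) →
                       ∀ e → u ∧ ⟦ e ⟧ ρ ≈ u ∧ ⟦ e ⟧ σ
  guarded-congruence u ρ σ agree (var i) = agree i
  guarded-congruence u ρ σ agree ⊤ₑ      = refl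
  guarded-congruence u ρ σ agree ⊥ₑ      = refl
  guarded-congruence u ρ σ agree (e ∧ₑ f) = begin
    u ∧ (⟦ e ⟧ ρ ∧ ⟦ f ⟧ ρ)          ≈⟨ ∧-guard u _ _ ⟩
    (u ∧ ⟦ e ⟧ ρ) ∧ (u ∧ ⟦ f ⟧ ρ)    ≈⟨ ∧-cong (guarded-congruence u ρ σ agree e)
                                               (guarded-congruence u ρ σ agree f) ⟩
    (u ∧ ⟦ e ⟧ σ) ∧ (u ∧ ⟦ f ⟧ σ)    ≈⟨ ∧-guard u _ _ ⟨
    u ∧ (⟦ e ⟧ σ ∧ ⟦ f ⟧ σ)          ∎
  guarded-congruence u ρ σ agree (e ∨ₑ f) = begin
    u ∧ (⟦ e ⟧ ρ ∨ ⟦ f ⟧ ρ)          ≈⟨ ∧-distribˡ-∨ _ _ _ ⟩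
    (u ∧ ⟦ e ⟧ ρ) ∨ (u ∧ ⟦ f ⟧ ρ)    ≈⟨ ∨-cong (guarded-congruence u ρ σ agree e)
                                               (guarded-congruence u ρ σ agree f) ⟩
    (u ∧ ⟦ e ⟧ σ) ∨ (u ∧ ⟦ f ⟧ σ)    ≈⟨ ∧-distribˡ-∨ _ _ _ ⟨
    u ∧ (⟦ e ⟧ σ ∨ ⟦ f ⟧ σ)          ∎
  guarded-congruence u ρ σ agree (¬ₑ e) = begin
    u ∧ ¬ ⟦ e ⟧ ρ          ≈⟨ ¬-guard u _ ⟩
    u ∧ ¬ (u ∧ ⟦ e ⟧ ρ)    ≈⟨ ∧-congˡ (¬-cong (guarded-congruence u ρ σ agree e)) ⟩
    u ∧ ¬ (u ∧ ⟦ e ⟧ σ)    ≈⟨ ¬-guard u _ ⟨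
    u ∧ ¬ ⟦ e ⟧ σ          ∎

  split : ∀ v t → t ≈ (v ∧ t) ∨ (¬ v ∧ t)
  split v t = begin
    t                    ≈⟨ ∧-identityˡ t ⟨
    ⊤ ∧ t                ≈⟨ ∧-congʳ (∨-complementʳ v) ⟨
    (v ∨ ¬ v) ∧ t        ≈⟨ ∧-distribʳ-∨ t v (¬ v) ⟩
    (v ∧ t) ∨ (¬ v ∧ t)  ∎

  shannon : ∀ {n} (e : Expr (suc n)) (ρ : Fin (suc n) → Carrier) →
            ⟦ e ⟧ ρ ≈ (ρ zero ∧ ⟦ instantiate true e ⟧ (tail ρ))
                    ∨ (¬ ρ zero ∧ ⟦ instantiate false e ⟧ (tail ρ))
  shannon e ρ = begin
    ⟦ e ⟧ ρ                                          ≈⟨ split v _ ⟩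
    (v ∧ ⟦ e ⟧ ρ) ∨ (¬ v ∧ ⟦ e ⟧ ρ)                  ≈⟨ ∨-cong
      (guarded-congruence v ρ (⊤ ∷ᵛ tail ρ) below-v e)
      (guarded-congruence (¬ v) ρ (⊥ ∷ᵛ tail ρ) below-¬v e) ⟩
    (v ∧ ⟦ e ⟧ (⊤ ∷ᵛ tail ρ)) ∨ (¬ v ∧ ⟦ e ⟧ (⊥ ∷ᵛ tail ρ)) ≈⟨ reflexive (≡.cong₂ _∨_
      (≡.cong (v ∧_) (instantiate-sem true e (tail ρ)))
      (≡.cong (¬ v ∧_) (instantiate-sem false e (tail ρ)))) ⟨
    (v ∧ ⟦ instantiate true e ⟧ (tail ρ)) ∨ (¬ v ∧ ⟦ instantiate false e ⟧ (tail ρ)) ∎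
    where
    v : Carrier
    v = ρ zero
    below-v : ∀ i → v ∧ ρ i ≈ v ∧ (⊤ ∷ᵛ tail ρ) i
    below-v zero    = trans (∧-idem v) (sym (∧-identityʳ v))
    below-v (suc i) = refl
    below-¬v : ∀ i → ¬ v ∧ ρ i ≈ ¬ v ∧ (⊥ ∷ᵛ tail ρ) i
    below-¬v zero    = trans (∧-complementˡ v) (sym (∧-zeroʳ _))
    below-¬v (suc i) = refl

  tautology-sound : ∀ n (e : Expr n) → T (isTautology n e) → ∀ ρ → ⟦ e ⟧ ρ ≈ ⊤
  tautology-sound zero e taut ρ with evaluate e | evaluate-sound e ρ
  ... | true | e≈⊤ = e≈⊤
  tautology-sound (suc n) e taut ρ = begin
    ⟦ e ⟧ ρ                                       ≈⟨ shannon e ρ ⟩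
    (v ∧ ⟦ e⊤ ⟧ (tail ρ)) ∨ (¬ v ∧ ⟦ e⊥ ⟧ (tail ρ)) ≈⟨ ∨-cong
      (∧-congˡ (tautology-sound n e⊤ taut⊤ (tail ρ)))
      (∧-congˡ (tautology-sound n e⊥ taut⊥ (tail ρ))) ⟩
    (v ∧ ⊤) ∨ (¬ v ∧ ⊤)                           ≈⟨ ∨-cong (∧-identityʳ v) (∧-identityʳ (¬ v)) ⟩
    v ∨ ¬ v                                       ≈⟨ ∨-complementʳ v ⟩
    ⊤                                             ∎
    where
    v : Carrier
    v = ρ zero
    e⊤ e⊥ : Expr n
    e⊤ = instantiate true e
    e⊥ = instantiate false e
    taut⊤ : T (isTautology n e⊤)
    taut⊤ = proj₁ (Equivalence.to T-∧ taut)
    taut⊥ : T (isTautology n e⊥)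
    taut⊥ = proj₂ (Equivalence.to T-∧ taut)

  -- An equation x ≈ y is
  -- encoded as the biconditional of x and y taking the value ⊤; the lemmas
  -- below translate equations, conjunctions and implications to and from ⊤.
  infix  4 _⇔ₑ_
  infixr 5 _⇒ₑ_
  _⇒ₑ_ _⇔ₑ_ : ∀ {n} → Expr n → Expr n → Expr n
  e ⇒ₑ f = ¬ₑ e ∨ₑ f
  e ⇔ₑ f = (e ⇒ₑ f) ∧ₑ (f ⇒ₑ e)

  ∧-⊤ : ∀ {x y} → x ≈ ⊤ → y ≈ ⊤ → x ∧ y ≈ ⊤
  ∧-⊤ x≈⊤ y≈⊤ = trans (∧-cong x≈⊤ y≈⊤) (∧-identityˡ ⊤)

  ∧-⊤ˡ : ∀ {x y} → x ∧ y ≈ ⊤ → x ≈ ⊤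
  ∧-⊤ˡ {x} {y} x∧y≈⊤ = begin
    x            ≈⟨ ∨-absorbs-∧ x y ⟨
    x ∨ (x ∧ y)  ≈⟨ ∨-congˡ x∧y≈⊤ ⟩
    x ∨ ⊤        ≈⟨ ∨-zeroʳ x ⟩
    ⊤            ∎

  ∧-⊤ʳ : ∀ {x y} → x ∧ y ≈ ⊤ → y ≈ ⊤
  ∧-⊤ʳ {x} {y} x∧y≈⊤ = ∧-⊤ˡ (trans (∧-comm y x) x∧y≈⊤)

  modus-ponens : ∀ {x y} → x ≈ ⊤ → ¬ x ∨ y ≈ ⊤ → y ≈ ⊤
  modus-ponens {x} {y} x≈⊤ x⇒y≈⊤ = begin
    y          ≈⟨ ∨-identityˡ y ⟨
    ⊥ ∨ y      ≈⟨ ∨-congʳ (trans (¬-cong x≈⊤) ¬⊤≈⊥) ⟨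
    ¬ x ∨ y    ≈⟨ x⇒y≈⊤ ⟩
    ⊤          ∎

  ⇒-⊤-≤ : ∀ {x y} → ¬ x ∨ y ≈ ⊤ → x ≈ x ∧ y
  ⇒-⊤-≤ {x} {y} x⇒y≈⊤ = begin
    x                    ≈⟨ ∧-identityʳ x ⟨
    x ∧ ⊤                ≈⟨ ∧-congˡ x⇒y≈⊤ ⟨
    x ∧ (¬ x ∨ y)        ≈⟨ ∧-distribˡ-∨ _ _ _ ⟩
    (x ∧ ¬ x) ∨ (x ∧ y)  ≈⟨ ∨-congʳ (∧-complementʳ x) ⟩
    ⊥ ∨ (x ∧ y)          ≈⟨ ∨-identityˡ _ ⟩
    x ∧ y                ∎

  ≈-⇔-⊤ : ∀ {x y} → x ≈ y → (¬ x ∨ y) ∧ (¬ y ∨ x) ≈ ⊤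
  ≈-⇔-⊤ {x} {y} x≈y = begin
    (¬ x ∨ y) ∧ (¬ y ∨ x)  ≈⟨ ∧-cong (∨-congʳ (¬-cong x≈y)) (∨-congˡ x≈y) ⟩
    (¬ y ∨ y) ∧ (¬ y ∨ y)  ≈⟨ ∧-idem _ ⟩
    ¬ y ∨ y                ≈⟨ ∨-complementˡ y ⟩
    ⊤                      ∎

  ⇔-⊤-≈ : ∀ {x y} → (¬ x ∨ y) ∧ (¬ y ∨ x) ≈ ⊤ → x ≈ y
  ⇔-⊤-≈ {x} {y} x⇔y≈⊤ = begin
    x      ≈⟨ ⇒-⊤-≤ (∧-⊤ˡ x⇔y≈⊤) ⟩
    x ∧ y  ≈⟨ ∧-comm x y ⟩
    y ∧ x  ≈⟨ ⇒-⊤-≤ (∧-⊤ʳ x⇔y≈⊤) ⟨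
    y      ∎

  Equation : ℕ → Set
  Equation n = Expr n × Expr n

  Holds : ∀ {n} → (Fin n → Carrier) → Equation n → Set ℓ
  Holds ρ (e , f) = ⟦ e ⟧ ρ ≈ ⟦ f ⟧ ρ

  ⋀ : ∀ {n} → List (Equation n) → Expr n
  ⋀ []             = ⊤ₑ
  ⋀ ((e , f) ∷ es) = (e ⇔ₑ f) ∧ₑ ⋀ es

  all-hold : ∀ {n} (ρ : Fin n → Carrier) (es : List (Equation n)) →
             All (Holds ρ) es → ⟦ ⋀ es ⟧ ρ ≈ ⊤
  all-hold ρ []       []       = refl
  all-hold ρ (_ ∷ es) (h ∷ hs) = ∧-⊤ (≈-⇔-⊤ h) (all-hold ρ es hs)

  Entails : ∀ n → List (Equation n) → Equation n → Bool
  Entails n hyps (e , f) = isTautology n (⋀ hyps ⇒ₑ (e ⇔ₑ f))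

  entailment-sound : ∀ n (hyps : List (Equation n)) (concl : Equation n) →
                     T (Entails n hyps concl) →
                     ∀ ρ → All (Holds ρ) hyps → Holds ρ concl
  entailment-sound n hyps (e , f) taut ρ hs =
    ⇔-⊤-≈ (modus-ponens (all-hold ρ hyps hs) (tautology-sound n _ taut ρ))

module SimilarityAndLength {c ℓ : Level} (B : BooleanAlgebra c ℓ) where
  open BooleanAlgebra B
  open IntervalAlgebra B
  open BooleanTerms B

  b₀ b₁ d₀ d₁ : Expr 4
  b₀ = var zero
  b₁ = var (suc zero)
  d₀ = var (suc (suc zero))
  d₁ = var (suc (suc (suc zero)))

  endpoints : Interval → Interval → Fin 4 → Carrier
  endpoints b d = lo b ∷ᵛ hi b ∷ᵛ lo d ∷ᵛ hi d ∷ᵛ []ᵛ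

  -- Terms for the endpoints of Δ(b ∨ d , b), built from b ∨ d = [b₀ ∧ d₀ , b₁ ∨ d₁]
  -- exactly as in the definition of Δ, and for the lengths of b and d.
  Δ₀ Δ₁ len-b len-d : Expr 4
  Δ₀ = (b₀ ∧ₑ d₀) ∨ₑ ((b₁ ∨ₑ d₁) ∧ₑ ¬ₑ b₁)
  Δ₁ = (b₁ ∨ₑ d₁) ∧ₑ ((b₀ ∧ₑ d₀) ∨ₑ ¬ₑ b₀)
  len-b = ¬ₑ b₀ ∧ₑ b₁
  len-d = ¬ₑ d₀ ∧ₑ d₁

  are-intervals : List (Equation 4)
  are-intervals = (b₀ ∧ₑ b₁ , b₀) ∷ (d₀ ∧ₑ d₁ , d₀) ∷ []

  are-intervals-hold : ∀ b d → All (Holds (endpoints b d)) are-intervals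
  are-intervals-hold b d = lo≤hi b ∷ lo≤hi d ∷ []

  similar : List (Equation 4)
  similar = (Δ₀ , d₀) ∷ (Δ₁ , d₁) ∷ []

  same-length : Equation 4
  same-length = (len-b , len-d)

  ∼⇒same-length : ∀ b d → b ∼ d → len b ≈ len d
  ∼⇒same-length b d (Δ₀≈d₀ , Δ₁≈d₁) =
    entailment-sound 4 (are-intervals ++ similar) same-length tt (endpoints b d)
      (++⁺ (are-intervals-hold b d) (Δ₀≈d₀ ∷ Δ₁≈d₁ ∷ []))

  same-length⇒∼ : ∀ b d → len b ≈ len d → b ∼ d
  same-length⇒∼ b d len-eq = from-same-length (Δ₀ , d₀) tt , from-same-length (Δ₁ , d₁) tt
    where
    from-same-length : ∀ concl → T (Entails 4 (same-length ∷ are-intervals) concl) →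
                       Holds (endpoints b d) concl
    from-same-length concl taut = entailment-sound 4 (same-length ∷ are-intervals) concl taut
      (endpoints b d) (len-eq ∷ are-intervals-hold b d)

corollary2p9 : {c ℓ : Level} (B : BooleanAlgebra c ℓ) → Cor2p9 B
corollary2p9 B b d = mk⇔ (∼⇒same-length b d) (same-length⇒∼ b d)
  where open SimilarityAndLength B
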